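{- For all integers $r,k\geq 2$, $$P_r(k)\geq P_{r-1}(k) + f_{k,k+1}(P_r(k)).$$
   Context: All graphs are finite and simple; $K_k$ denotes the complete graph on $k$ vertices. A colour pattern on a vertex set $V$ is a sequence $G_1,\ldots,G_r$ of pairwise edge-disjoint graphs all with vertex set $V$; it is $K_{k+1}$-free if no $G_i$ contains $K_{k+1}$. Given a colour pattern $G_1,\dots,G_r$ on $V$ and a colouring $c:V\to[r]$, a strongly monochromatic $K_k$ is a set of $k$ vertices all of the same colour $i$ under $c$ which forms a clique in $G_i$. For $r\geq 1$, $P_r(k)$ is the smallest integer $n$ such that there exists a $K_{k+1}$-free colour pattern $G_1,\ldots,G_r$ on an $n$-element vertex set $V$ such that every colouring $V\to[r]$ contains a strongly monochromatic $K_k$. For a graph $F$, the $k$-independence number $\alpha_k(F)$ is the largest size of a vertex subset of $F$ containing no $K_k$. The Erdős–Rogers function $f_{k,k+1}(n)$ is the minimum of $\alpha_k(F)$ over all $K_{k+1}$-free graphs $F$ on $n$ vertices. -}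

module Defs where

open import Data.Nat using (ℕ; suc; _≤_)
open import Data.Fin using (Fin)
open import Data.Fin.Subset using (Subset; _∈_; ∣_∣)
open import Data.Bool using (Bool; true; false)
open import Data.Product using (Σ; ∃; _×_)
open import Relation.Binary.PropositionalEquality using (_≡_; _≢_)
open import Relation.Nullary using (¬_)
open import Function.Definitions using (Injective)

record Graph (n : ℕ) : Set where
  field
    adj    : Fin n → Fin n → Bool
    sym    : ∀ x y → adj x y ≡ adj y x
    irrefl : ∀ x → adj x x ≡ false
open Graph public

Adj : ∀ {n} → Graph n → Fin n → Fin n → Set
Adj G x y = adj G x y ≡ true

IsClique : ∀ {n} (k : ℕ) → Graph n → (Fin k → Fin n) → Set
IsClique k G f = Injective _≡_ _≡_ f × (∀ i j → i ≢ j → Adj G (f i) (f j))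

ContainsK : ∀ {n} (k : ℕ) → Graph n → Set
ContainsK k G = Σ (Fin _ → Fin _) (IsClique k G)

Pattern : ℕ → ℕ → Set
Pattern r n = Fin r → Graph n

EdgeDisjoint : ∀ {r n} → Pattern r n → Set
EdgeDisjoint {r} {n} G = ∀ (i j : Fin r) (x y : Fin n) → Adj (G i) x y → Adj (G j) x y → i ≡ j

KFreePattern : ∀ {r n} (k : ℕ) → Pattern r n → Set
KFreePattern {r} k G = ∀ (i : Fin r) → ¬ ContainsK (suc k) (G i)

StronglyMonoK : ∀ {r n} (k : ℕ) → Pattern r n → (Fin n → Fin r) → Set
StronglyMonoK {r} {n} k G c =
  Σ (Fin r) λ i → Σ (Fin k → Fin n) λ f → (∀ j → c (f j) ≡ i) × IsClique k (G i) f

GoodP : ℕ → ℕ → ℕ → Set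
GoodP r k n = Σ (Pattern r n) λ G →
  EdgeDisjoint G × KFreePattern k G × (∀ (c : Fin n → Fin r) → StronglyMonoK k G c)

IsLeast : (ℕ → Set) → ℕ → Set
IsLeast P n = P n × (∀ m → P m → n ≤ m)

IsP : ℕ → ℕ → ℕ → Set
IsP r k n = IsLeast (GoodP r k) n

KIndependent : ∀ {n} (k : ℕ) → Graph n → Subset n → Set
KIndependent k F S = ¬ (Σ (Fin _ → Fin _) λ f → IsClique k F f × (∀ j → f j ∈ S))

IsAlphaK : ∀ {n} (k : ℕ) → Graph n → ℕ → Set
IsAlphaK {n} k F a =
  (Σ (Subset n) λ S → KIndependent k F S × ∣ S ∣ ≡ a)
  × (∀ (S : Subset n) → KIndependent k F S → ∣ S ∣ ≤ a)

IsErdosRogers : ℕ → ℕ → ℕ → Set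
IsErdosRogers k n a =
  (Σ (Graph n) λ F → ¬ ContainsK (suc k) F × IsAlphaK k F a)
  × (∀ (F : Graph n) (b : ℕ) → ¬ ContainsK (suc k) F → IsAlphaK k F b → a ≤ b)

-- Take an optimal pattern G₀, …, G_{r-1} on n = P_r(k) vertices and a K_k-free set S of G₀
-- of size α_k(G₀) ≥ f_{k,k+1}(n). Removing S and the colour 0 leaves a K_{k+1}-free pattern
-- with r - 1 colours on n - |S| vertices which is still good: a colouring c of the remaining
-- vertices, extended by colour 0 on S, yields a strongly monochromatic K_k, which cannot have
-- colour 0 since S is K_k-free, so it lies outside S. Hence P_{r-1}(k) ≤ n - |S|.
module Submission where

open import Defs
open import Data.Nat using (ℕ; zero; suc; _≤_; _+_; _∸_; z≤n; s≤s; _≤?_)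
open import Data.Nat.Properties using (≤-trans; ≤-pred; ≤∧≢⇒<; +-monoʳ-≤; m≤o∸n⇒m+n≤o)
open import Data.Fin using (Fin; zero; suc)
open import Data.Fin.Properties using (suc-injective)
open import Data.Fin.Subset using (Subset; _∈_; ∣_∣; ∁; ⊥; inside; outside)
open import Data.Fin.Subset.Properties
  using (_∈?_; x∉∁p⇒x∈p; ∉⊥; ∣⊥∣≡0; ∣p∣≤n; ∣∁p∣≡n∸∣p∣)
open import Data.Vec using (_∷_; here; there)
open import Data.Product using (Σ; ∃; _×_; _,_; proj₁; proj₂)
open import Data.Empty using (⊥-elim)
open import Function using (_∘_)
open import Function.Definitions using (Injective)
open import Relation.Binary.PropositionalEquality as ≡ using (_≡_; refl; cong; subst; subst₂)
open import Relation.Nullary using (¬_; yes; no)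
open import Relation.Nullary.Decidable using (decidable-stable; ¬¬-excluded-middle)
open import Relation.Nullary.Negation using (¬¬-map)

member : ∀ {n} (p : Subset n) → Fin ∣ p ∣ → Fin n
member (inside ∷ p) zero = zero
member (inside ∷ p) (suc i) = suc (member p i)
member (outside ∷ p) i = suc (member p i)

member-injective : ∀ {n} (p : Subset n) → Injective _≡_ _≡_ (member p)
member-injective (inside ∷ p) {zero} {zero} _ = refl
member-injective (inside ∷ p) {suc i} {suc j} eq = cong suc (member-injective p (suc-injective eq))
member-injective (outside ∷ p) eq = member-injective p (suc-injective eq)

index : ∀ {n} {x : Fin n} (p : Subset n) → x ∈ p → Fin ∣ p ∣
index (inside ∷ p) here = zero
index (inside ∷ p) (there x∈p) = suc (index p x∈p)
index (outside ∷ p) (there x∈p) = index p x∈p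

member-index : ∀ {n} {x : Fin n} (p : Subset n) (x∈p : x ∈ p) → member p (index p x∈p) ≡ x
member-index (inside ∷ p) here = refl
member-index (inside ∷ p) (there x∈p) = cong suc (member-index p x∈p)
member-index (outside ∷ p) (there x∈p) = cong suc (member-index p x∈p)

induced : ∀ {n n′} → Graph n → (Fin n′ → Fin n) → Graph n′
induced G e = record
  { adj = λ x y → adj G (e x) (e y)
  ; sym = λ x y → sym G (e x) (e y)
  ; irrefl = λ x → irrefl G (e x)
  }

module _ {n n′ k : ℕ} (G : Graph n) (e : Fin n′ → Fin n) where

  induced-clique⇒clique : ∀ {f} → Injective _≡_ _≡_ e →
                          IsClique k (induced G e) f → IsClique k G (e ∘ f)
  induced-clique⇒clique e-inj (f-inj , f-adj) = f-inj ∘ e-inj , f-adj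

  clique⇒induced-clique : ∀ {f g} → (∀ j → e (g j) ≡ f j) →
                          IsClique k G f → IsClique k (induced G e) g
  clique⇒induced-clique {f} {g} eg≗f (f-inj , f-adj) = g-inj , g-adj
    where
    g-inj : Injective _≡_ _≡_ g
    g-inj {a} {b} ga≡gb = f-inj (≡.trans (≡.sym (eg≗f a)) (≡.trans (cong e ga≡gb) (eg≗f b)))

    g-adj : ∀ a b → ¬ a ≡ b → Adj (induced G e) (g a) (g b)
    g-adj a b a≢b = subst₂ (Adj G) (≡.sym (eg≗f a)) (≡.sym (eg≗f b)) (f-adj a b a≢b)

module DropColour {r n k : ℕ} (G : Pattern (suc r) n) (S : Subset n) where

  remaining : Pattern r ∣ ∁ S ∣
  remaining i = induced (G (suc i)) (member (∁ S))

  remaining-edgeDisjoint : EdgeDisjoint G → EdgeDisjoint remaining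
  remaining-edgeDisjoint disj i j x y xy∈Gi xy∈Gj =
    suc-injective (disj (suc i) (suc j) _ _ xy∈Gi xy∈Gj)

  remaining-kFree : KFreePattern k G → KFreePattern k remaining
  remaining-kFree free i (f , f-clique) =
    free (suc i) (member (∁ S) ∘ f ,
      induced-clique⇒clique (G (suc i)) (member (∁ S)) (member-injective (∁ S)) f-clique)

  extend : (Fin ∣ ∁ S ∣ → Fin r) → Fin n → Fin (suc r)
  extend c x with x ∈? ∁ S
  ... | yes x∈∁S = suc (c (index (∁ S) x∈∁S))
  ... | no _ = zero

  extend-zero : ∀ c x → extend c x ≡ zero → x ∈ S
  extend-zero c x eq with x ∈? ∁ S
  extend-zero c x () | yes _
  extend-zero c x refl | no x∉∁S = x∉∁p⇒x∈p x∉∁S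

  extend-suc : ∀ c x {i} → extend c x ≡ suc i → Σ (x ∈ ∁ S) λ x∈∁S → c (index (∁ S) x∈∁S) ≡ i
  extend-suc c x eq with x ∈? ∁ S
  extend-suc c x refl | yes x∈∁S = x∈∁S , refl
  extend-suc c x () | no _

  remaining-mono : KIndependent k (G zero) S → (∀ c → StronglyMonoK k G c) →
                   ∀ c → StronglyMonoK k remaining c
  remaining-mono indep mono c with mono (extend c)
  ... | zero , f , f-col , f-clique =
    ⊥-elim (indep (f , f-clique , λ j → extend-zero c (f j) (f-col j)))
  ... | suc i , f , f-col , f-clique =
    i , g , proj₂ ∘ outside-S , clique⇒induced-clique (G (suc i)) (member (∁ S)) mg≗f f-clique
    where
    outside-S : ∀ j → Σ (f j ∈ ∁ S) λ fj∈∁S → c (index (∁ S) fj∈∁S) ≡ i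
    outside-S j = extend-suc c (f j) (f-col j)

    g : Fin k → Fin ∣ ∁ S ∣
    g j = index (∁ S) (proj₁ (outside-S j))

    mg≗f : ∀ j → member (∁ S) (g j) ≡ f j
    mg≗f j = member-index (∁ S) (proj₁ (outside-S j))

  remaining-good : EdgeDisjoint G → KFreePattern k G → (∀ c → StronglyMonoK k G c) →
                   KIndependent k (G zero) S → GoodP r k ∣ ∁ S ∣
  remaining-good disj free mono indep =
    remaining , remaining-edgeDisjoint disj , remaining-kFree free , remaining-mono indep mono

P+independent≤n : ∀ {r k n m} (G : Pattern (suc r) n) → EdgeDisjoint G → KFreePattern k G →
                  (∀ c → StronglyMonoK k G c) → IsP r k m →
                  ∀ S → KIndependent k (G zero) S → m + ∣ S ∣ ≤ n
P+independent≤n {m = m} G disj free mono (_ , m-least) S indep =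
  m≤o∸n⇒m+n≤o m (∣p∣≤n S)
    (subst (m ≤_) (∣∁p∣≡n∸∣p∣ S) (m-least _ (DropColour.remaining-good G S disj free mono indep)))

¬¬-greatest : ∀ {p} (P : ℕ → Set p) {z N} → P z → (∀ j → P j → j ≤ N) →
              ¬ ¬ (Σ ℕ λ b → P b × (∀ j → P j → j ≤ b))
¬¬-greatest P {z} Pz = search _
  where
  search : ∀ t → (∀ j → P j → j ≤ t) → ¬ ¬ (Σ ℕ λ b → P b × (∀ j → P j → j ≤ b))
  search zero ≤0 none = none (z , Pz , λ j Pj → ≤-trans (≤0 j Pj) z≤n)
  search (suc t) ≤t+1 none = ¬¬-excluded-middle λ
    { (yes Pt+1) → none (suc t , Pt+1 , ≤t+1)
    ; (no ¬Pt+1) → search t (λ j Pj → ≤-pred (≤∧≢⇒< (≤t+1 j Pj) λ { refl → ¬Pt+1 Pj })) none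
    }

¬¬-αₖ : ∀ {n} k (F : Graph n) → ¬ ¬ ∃ (IsAlphaK (suc k) F)
¬¬-αₖ {n} k F = ¬¬-map toIsAlphaK
  (¬¬-greatest attained (⊥ , empty-independent , ∣⊥∣≡0 n) λ { j (S , _ , refl) → ∣p∣≤n S })
  where
  attained : ℕ → Set
  attained j = Σ (Subset n) λ S → KIndependent (suc k) F S × ∣ S ∣ ≡ j

  empty-independent : KIndependent (suc k) F ⊥
  empty-independent (_ , _ , f∈⊥) = ∉⊥ (f∈⊥ zero)

  toIsAlphaK : Σ ℕ (λ b → attained b × (∀ j → attained j → j ≤ b)) → ∃ (IsAlphaK (suc k) F)
  toIsAlphaK (b , witness , greatest) = b , witness , λ S indep → greatest ∣ S ∣ (S , indep , refl)

proposition3p2 : ∀ (r k n m a : ℕ) → 2 ≤ r → 2 ≤ k →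
    IsP r k n → IsP (r ∸ 1) k m → IsErdosRogers k n a → m + a ≤ n
proposition3p2 (suc r) (suc k) n m a (s≤s _) (s≤s _) ((G , disj , free , mono) , _) m-isP (_ , a-least) =
  -- α_k(G₀) is only available under double negation, but the goal is decidable.
  decidable-stable (m + a ≤? n) (¬¬-map bound (¬¬-αₖ k (G zero)))
  where
  bound : ∃ (IsAlphaK (suc k) (G zero)) → m + a ≤ n
  bound (b , α@((S , indep , refl) , _)) =
    ≤-trans (+-monoʳ-≤ m (a-least (G zero) b (free zero) α))
            (P+independent≤n G disj free mono m-isP S indep)
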